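{- Let $\mathcal{B}$ be a reflexive binary relation on $SC$. For every $\rho\in SC$, either $\rho\xrightarrow{\mathsf{ok}}$, or $\rho\mid\overline{\rho}$ has a $\tau$-transition with respect to $\mathcal{B}$.
   Context: Fix a set $BT$ of base types with a preorder $\le_:$ and a countable set of labels. Contract terms: $\sigma ::= \mathbf{1} \mid ?t.\sigma \mid !t.\sigma \mid ?(\sigma').\sigma \mid !(\sigma').\sigma \mid \sum_{i\in I} ?l_i.\sigma_i \mid \bigoplus_{i\in I} !l_i.\sigma_i \mid \mu x.\sigma \mid x$ ($t\in BT$, $I$ finite nonempty, labels pairwise distinct; $!l.\sigma$ is the one-summand internal sum). A term is guarded if for every subterm $\mu x.\sigma$, every occurrence of $x$ in $\sigma$ lies under a constructor other than $\mu$; $SC$ is the set of closed guarded terms. Transitions: $\mathbf{1}\xrightarrow{\mathsf{ok}}$; $\lambda.\sigma\xrightarrow{\lambda}\sigma$ for prefixes $\lambda\in\{?l,!l,?t,!t,?(\sigma'),!(\sigma')\}$; $\sum_{i\in I}?l_i.\sigma_i\xrightarrow{?l_k}\sigma_k$; $\bigoplus_{i\in I}!l_i.\sigma_i\xrightarrow{\tau}!l_k.\sigma_k$ when $|I|>1$; $\mu x.\sigma\xrightarrow{\tau}\sigma\{\mu x.\sigma/x\}$; nothing else. $\lambda_1\bowtie_{\mathcal{B}}\lambda_2$ iff $(\lambda_1,\lambda_2)$ is $(!l,?l)$, $(?l,!l)$, $(!t_1,?t_2)$ with $t_1\le_:t_2$, $(?t_1,!t_2)$ with $t_2\le_:t_1$,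 $(!(\sigma_1),?(\sigma_2))$ with $\sigma_1\mathcal{B}\sigma_2$, or $(?(\sigma_1),!(\sigma_2))$ with $\sigma_2\mathcal{B}\sigma_1$. $\rho\mid\sigma\xrightarrow{\tau}_{\mathcal{B}}\rho'\mid\sigma'$ iff $\rho\xrightarrow{\tau}\rho'$, $\sigma'=\sigma$; or $\sigma\xrightarrow{\tau}\sigma'$, $\rho'=\rho$; or $\rho\xrightarrow{\lambda_1}\rho'$, $\sigma\xrightarrow{\lambda_2}\sigma'$, $\lambda_1\bowtie_{\mathcal{B}}\lambda_2$. The standard dual: $\overline{\mathbf{1}}=\mathbf{1}$, $\overline{x}=x$, $\overline{\mu x.\sigma}=\mu x.\overline{\sigma}$, $\overline{?t.\sigma}=!t.\overline{\sigma}$, $\overline{!t.\sigma}=?t.\overline{\sigma}$, $\overline{?(\sigma^m).\sigma}=!(\sigma^m).\overline{\sigma}$, $\overline{!(\sigma^m).\sigma}=?(\sigma^m).\overline{\sigma}$ (messages unchanged), $\overline{\sum_{i\in I}?l_i.\sigma_i}=\bigoplus_{i\in I}!l_i.\overline{\sigma_i}$, $\overline{\bigoplus_{i\in I}!l_i.\sigma_i}=\sum_{i\in I}?l_i.\overline{\sigma_i}$. -}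

module Defs where

open import Data.Nat using (ℕ; _≟_)
open import Data.Product using (Σ; _×_; _,_; proj₁; ∃-syntax)
open import Data.List using (List; []; _∷_)
open import Data.List.Relation.Unary.Unique.Propositional using (Unique)
open import Relation.Nullary using (¬_; yes; no)
open import Relation.Binary.PropositionalEquality using (_≡_)

Label : Set
Label = ℕ

Var : Set
Var = ℕ

-- Contract terms over a set BT of base types.
-- Internal/external sums are given by a nonempty list of branches;
-- the prefixes ?l.σ and !l.σ are the one-summand sums.
mutual
  data Term (BT : Set) : Set where
    one  : Term BT
    inT  : BT → Term BT → Term BT
    outT : BT → Term BT → Term BT
    inS  : Term BT → Term BT → Term BT
    outS : Term BT → Term BT → Term BT
    ext  : Branches BT → Term BT
    int  : Branches BT → Term BT
    mu   : Var → Term BT → Term BT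
    var  : Var → Term BT

  data Branches (BT : Set) : Set where
    [_↦_]   : Label → Term BT → Branches BT
    _↦_∷_   : Label → Term BT → Branches BT → Branches BT

infixr 5 _↦_∷_

labels : ∀ {BT} → Branches BT → List Label
labels [ l ↦ σ ] = l ∷ []
labels (l ↦ σ ∷ bs) = l ∷ labels bs

data _↦_∈B_ {BT : Set} (l : Label) (σ : Term BT) : Branches BT → Set where
  single : l ↦ σ ∈B [ l ↦ σ ]
  here   : ∀ {bs} → l ↦ σ ∈B (l ↦ σ ∷ bs)
  there  : ∀ {l' σ' bs} → l ↦ σ ∈B bs → l ↦ σ ∈B (l' ↦ σ' ∷ bs)

mutual
  data Distinct {BT : Set} : Term BT → Set where
    one  : Distinct one
    inT  : ∀ {t σ} → Distinct σ → Distinct (inT t σ)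
    outT : ∀ {t σ} → Distinct σ → Distinct (outT t σ)
    inS  : ∀ {m σ} → Distinct m → Distinct σ → Distinct (inS m σ)
    outS : ∀ {m σ} → Distinct m → Distinct σ → Distinct (outS m σ)
    ext  : ∀ {bs} → Unique (labels bs) → DistinctB bs → Distinct (ext bs)
    int  : ∀ {bs} → Unique (labels bs) → DistinctB bs → Distinct (int bs)
    mu   : ∀ {x σ} → Distinct σ → Distinct (mu x σ)
    var  : ∀ {x} → Distinct (var x)

  data DistinctB {BT : Set} : Branches BT → Set where
    [_]  : ∀ {l σ} → Distinct σ → DistinctB [ l ↦ σ ]
    _∷_  : ∀ {l σ bs} → Distinct σ → DistinctB bs → DistinctB (l ↦ σ ∷ bs)

mutual
  data FreeIn {BT : Set} (x : Var) : Term BT → Set where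
    var   : FreeIn x (var x)
    inT   : ∀ {t σ} → FreeIn x σ → FreeIn x (inT t σ)
    outT  : ∀ {t σ} → FreeIn x σ → FreeIn x (outT t σ)
    inSm  : ∀ {m σ} → FreeIn x m → FreeIn x (inS m σ)
    inSc  : ∀ {m σ} → FreeIn x σ → FreeIn x (inS m σ)
    outSm : ∀ {m σ} → FreeIn x m → FreeIn x (outS m σ)
    outSc : ∀ {m σ} → FreeIn x σ → FreeIn x (outS m σ)
    ext   : ∀ {bs} → FreeInB x bs → FreeIn x (ext bs)
    int   : ∀ {bs} → FreeInB x bs → FreeIn x (int bs)
    mu    : ∀ {y σ} → ¬ (x ≡ y) → FreeIn x σ → FreeIn x (mu y σ)

  data FreeInB {BT : Set} (x : Var) : Branches BT → Set where
    single : ∀ {l σ} → FreeIn x σ → FreeInB x [ l ↦ σ ]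
    here   : ∀ {l σ bs} → FreeIn x σ → FreeInB x (l ↦ σ ∷ bs)
    there  : ∀ {l σ bs} → FreeInB x bs → FreeInB x (l ↦ σ ∷ bs)

Closed : ∀ {BT} → Term BT → Set
Closed σ = ∀ x → ¬ FreeIn x σ

data Unguarded {BT : Set} (x : Var) : Term BT → Set where
  var : Unguarded x (var x)
  mu  : ∀ {y σ} → ¬ (x ≡ y) → Unguarded x σ → Unguarded x (mu y σ)

mutual
  data Guarded {BT : Set} : Term BT → Set where
    one  : Guarded one
    inT  : ∀ {t σ} → Guarded σ → Guarded (inT t σ)
    outT : ∀ {t σ} → Guarded σ → Guarded (outT t σ)
    inS  : ∀ {m σ} → Guarded m → Guarded σ → Guarded (inS m σ)
    outS : ∀ {m σ} → Guarded m → Guarded σ → Guarded (outS m σ)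
    ext  : ∀ {bs} → GuardedB bs → Guarded (ext bs)
    int  : ∀ {bs} → GuardedB bs → Guarded (int bs)
    mu   : ∀ {x σ} → ¬ Unguarded x σ → Guarded σ → Guarded (mu x σ)
    var  : ∀ {x} → Guarded (var x)

  data GuardedB {BT : Set} : Branches BT → Set where
    [_]  : ∀ {l σ} → Guarded σ → GuardedB [ l ↦ σ ]
    _∷_  : ∀ {l σ bs} → Guarded σ → GuardedB bs → GuardedB (l ↦ σ ∷ bs)

SC : Set → Set
SC BT = Σ (Term BT) (λ σ → Closed σ × Guarded σ × Distinct σ)

mutual
  _[_/_] : ∀ {BT} → Term BT → Term BT → Var → Term BT
  one [ s / x ] = one
  inT t σ [ s / x ] = inT t (σ [ s / x ])
  outT t σ [ s / x ] = outT t (σ [ s / x ])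
  inS m σ [ s / x ] = inS (m [ s / x ]) (σ [ s / x ])
  outS m σ [ s / x ] = outS (m [ s / x ]) (σ [ s / x ])
  ext bs [ s / x ] = ext (substB bs s x)
  int bs [ s / x ] = int (substB bs s x)
  mu y σ [ s / x ] with x ≟ y
  ... | yes _ = mu y σ
  ... | no _  = mu y (σ [ s / x ])
  var y [ s / x ] with x ≟ y
  ... | yes _ = s
  ... | no _  = var y

  substB : ∀ {BT} → Branches BT → Term BT → Var → Branches BT
  substB [ l ↦ σ ] s x = [ l ↦ σ [ s / x ] ]
  substB (l ↦ σ ∷ bs) s x = l ↦ σ [ s / x ] ∷ substB bs s x

-- actions other than ok
data Act (BT : Set) : Set where
  τ    : Act BT
  inL  : Label → Act BT
  outL : Label → Act BT
  inB  : BT → Act BT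
  outB : BT → Act BT
  inM  : Term BT → Act BT
  outM : Term BT → Act BT

data Ok {BT : Set} : Term BT → Set where
  one : Ok one

data _—[_]→_ {BT : Set} : Term BT → Act BT → Term BT → Set where
  inT  : ∀ {t σ} → inT t σ —[ inB t ]→ σ
  outT : ∀ {t σ} → outT t σ —[ outB t ]→ σ
  inS  : ∀ {m σ} → inS m σ —[ inM m ]→ σ
  outS : ∀ {m σ} → outS m σ —[ outM m ]→ σ
  ext  : ∀ {bs l σ} → l ↦ σ ∈B bs → ext bs —[ inL l ]→ σ
  out  : ∀ {l σ} → int [ l ↦ σ ] —[ outL l ]→ σ
  int  : ∀ {l σ bs l' σ'} → l' ↦ σ' ∈B (l ↦ σ ∷ bs) →
         int (l ↦ σ ∷ bs) —[ τ ]→ int [ l' ↦ σ' ]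
  mu   : ∀ {x σ} → mu x σ —[ τ ]→ (σ [ mu x σ / x ])

data Compat {BT : Set} (_≤:_ : BT → BT → Set) (B : SC BT → SC BT → Set)
     : Act BT → Act BT → Set where
  outIn  : ∀ {l} → Compat _≤:_ B (outL l) (inL l)
  inOut  : ∀ {l} → Compat _≤:_ B (inL l) (outL l)
  outInT : ∀ {t₁ t₂} → t₁ ≤: t₂ → Compat _≤:_ B (outB t₁) (inB t₂)
  inOutT : ∀ {t₁ t₂} → t₂ ≤: t₁ → Compat _≤:_ B (inB t₁) (outB t₂)
  outInS : ∀ {σ₁ σ₂} (p₁ : Closed σ₁ × Guarded σ₁ × Distinct σ₁)
             (p₂ : Closed σ₂ × Guarded σ₂ × Distinct σ₂) →
           B (σ₁ , p₁) (σ₂ , p₂) → Compat _≤:_ B (outM σ₁) (inM σ₂)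
  inOutS : ∀ {σ₁ σ₂} (p₁ : Closed σ₁ × Guarded σ₁ × Distinct σ₁)
             (p₂ : Closed σ₂ × Guarded σ₂ × Distinct σ₂) →
           B (σ₂ , p₂) (σ₁ , p₁) → Compat _≤:_ B (inM σ₁) (outM σ₂)

data ParStep {BT : Set} (_≤:_ : BT → BT → Set) (B : SC BT → SC BT → Set)
     : Term BT → Term BT → Term BT → Term BT → Set where
  left  : ∀ {ρ ρ' σ} → ρ —[ τ ]→ ρ' → ParStep _≤:_ B ρ σ ρ' σ
  right : ∀ {ρ σ σ'} → σ —[ τ ]→ σ' → ParStep _≤:_ B ρ σ ρ σ'
  sync  : ∀ {ρ ρ' σ σ' λ₁ λ₂} → ρ —[ λ₁ ]→ ρ' → σ —[ λ₂ ]→ σ' →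
          Compat _≤:_ B λ₁ λ₂ → ParStep _≤:_ B ρ σ ρ' σ'

mutual
  dual : ∀ {BT} → Term BT → Term BT
  dual one = one
  dual (var x) = var x
  dual (mu x σ) = mu x (dual σ)
  dual (inT t σ) = outT t (dual σ)
  dual (outT t σ) = inT t (dual σ)
  dual (inS m σ) = outS m (dual σ)
  dual (outS m σ) = inS m (dual σ)
  dual (ext bs) = int (dualB bs)
  dual (int bs) = ext (dualB bs)

  dualB : ∀ {BT} → Branches BT → Branches BT
  dualB [ l ↦ σ ] = [ l ↦ dual σ ]
  dualB (l ↦ σ ∷ bs) = l ↦ dual σ ∷ dualB bs

-- A closed term is never a bare variable, so it is 1, a μ-unfolding, a proper sum, or a
-- single prefix. An unfolding or an internal choice steps on the side where it occurs (an
-- external sum is an internal choice in the dual); a single prefix synchronises with the dual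
-- prefix, for base types by reflexivity of ≤: and for session messages by reflexivity of B.
module Submission where

open import Defs
open import Data.Product using (_×_; ∃-syntax; proj₁; _,_)
open import Data.Sum using (_⊎_; inj₁; inj₂)
open import Data.Empty using (⊥-elim)
open import Relation.Binary.PropositionalEquality using (_≡_)
open import Relation.Binary.Structures using (IsPreorder)
open import Relation.Binary.Definitions using (Reflexive)

WellFormed : ∀ {BT} → Term BT → Set
WellFormed σ = Closed σ × Guarded σ × Distinct σ

inS-message-wellFormed : ∀ {BT} {m σ : Term BT} → WellFormed (inS m σ) → WellFormed m
inS-message-wellFormed (c , inS gm _ , inS dm _) = (λ x f → c x (inSm f)) , gm , dm

outS-message-wellFormed : ∀ {BT} {m σ : Term BT} → WellFormed (outS m σ) → WellFormed m
outS-message-wellFormed (c , outS gm _ , outS dm _) = (λ x f → c x (outSm f)) , gm , dm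

module _ {BT : Set} {_≤:_ : BT → BT → Set} {B : SC BT → SC BT → Set}
         (≤:-refl : Reflexive _≤:_) (B-refl : Reflexive B) where

  ParProgress : Term BT → Term BT → Set
  ParProgress ρ σ = ∃[ ρ' ] ∃[ σ' ] ParStep _≤:_ B ρ σ ρ' σ'

  ok⊎progress-with-dual : (ρ : Term BT) → WellFormed ρ → Ok ρ ⊎ ParProgress ρ (dual ρ)
  ok⊎progress-with-dual one _ = inj₁ one
  ok⊎progress-with-dual (var x) (c , _) = ⊥-elim (c x var)
  ok⊎progress-with-dual (mu x σ) _ = inj₂ (_ , _ , left mu)
  ok⊎progress-with-dual (inT t σ) _ = inj₂ (_ , _ , sync inT outT (inOutT ≤:-refl))
  ok⊎progress-with-dual (outT t σ) _ = inj₂ (_ , _ , sync outT inT (outInT ≤:-refl))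
  ok⊎progress-with-dual (inS m σ) wf =
    inj₂ (_ , _ , sync inS outS (inOutS p p B-refl))
    where p = inS-message-wellFormed wf
  ok⊎progress-with-dual (outS m σ) wf =
    inj₂ (_ , _ , sync outS inS (outInS p p B-refl))
    where p = outS-message-wellFormed wf
  ok⊎progress-with-dual (ext [ l ↦ σ ]) _ = inj₂ (_ , _ , sync (ext single) out inOut)
  ok⊎progress-with-dual (ext (l ↦ σ ∷ bs)) _ = inj₂ (_ , _ , right (int here))
  ok⊎progress-with-dual (int [ l ↦ σ ]) _ = inj₂ (_ , _ , sync out (ext single) outIn)
  ok⊎progress-with-dual (int (l ↦ σ ∷ bs)) _ = inj₂ (_ , _ , left (int here))

lemma5p6 : (BT : Set) (_≤:_ : BT → BT → Set) → IsPreorder _≡_ _≤:_ →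
    (B : SC BT → SC BT → Set) → Reflexive B →
    (ρ : SC BT) →
    Ok (proj₁ ρ) ⊎ (∃[ ρ' ] ∃[ σ' ] ParStep _≤:_ B (proj₁ ρ) (dual (proj₁ ρ)) ρ' σ')
lemma5p6 BT _≤:_ ≤:-preorder B B-refl (ρ , wf) =
  ok⊎progress-with-dual (IsPreorder.refl ≤:-preorder) B-refl ρ wf
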